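{- Let $p$ be an odd prime, $q=p^e$ with $e\ge1$, $k$ an integer with $0\le k\le p-1$, and $l_1,l_2,l_3,l_4$ non-negative integers. Then $D_{p^{l_1}+p^{l_2}+p^{l_3}+p^{l_4},k}(1,x)$ is a permutation polynomial of $\mathbb{F}_q$ if and only if \[\begin{aligned}h(x)={}&(2-k)\,x^{\frac{p^{l_1}+p^{l_2}+p^{l_3}+p^{l_4}}{2}}+k\Big[x^{\frac{p^{l_1}+p^{l_2}+p^{l_3}-1}{2}}+x^{\frac{p^{l_1}+p^{l_2}+p^{l_4}-1}{2}}+x^{\frac{p^{l_1}+p^{l_3}+p^{l_4}-1}{2}}+x^{\frac{p^{l_2}+p^{l_3}+p^{l_4}-1}{2}}\Big]\\&+(2-k)\Big[x^{\frac{p^{l_1}+p^{l_2}}{2}}+x^{\frac{p^{l_1}+p^{l_3}}{2}}+x^{\frac{p^{l_2}+p^{l_3}}{2}}+x^{\frac{p^{l_1}+p^{l_4}}{2}}+x^{\frac{p^{l_2}+p^{l_4}}{2}}+x^{\frac{p^{l_3}+p^{l_4}}{2}}\Big]\\&+k\Big[x^{\frac{p^{l_1}-1}{2}}+x^{\frac{p^{l_2}-1}{2}}+x^{\frac{p^{l_3}-1}{2}}+x^{\frac{p^{l_4}-1}{2}}\Big]\end{aligned}\] is a permutation polynomial of $\mathbb{F}_q$.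
   Context: For an odd prime $p$ and $0\le k\le p-1$: for $n\ge 1$, $D_{n,k}(1,x)=\sum_{i=0}^{\lfloor n/2\rfloor}\frac{n-ki}{n-i}\binom{n-i}{i}(-x)^i$, where the coefficient is the integer $\binom{n-i}{i}-(k-1)\binom{n-i-1}{i-1}$ (with $\binom{m}{ -1}=0$) viewed in $\mathbb{F}_p$; $D_{0,k}(1,x)=2-k$. Equivalently $D_{1,k}=1$ and $D_{n,k}=D_{n-1,k}-xD_{n-2,k}$ for $n\ge2$. A polynomial over $\mathbb{F}_q$ is a permutation polynomial of $\mathbb{F}_q$ if it induces a bijection of $\mathbb{F}_q$. Here $x^0$ means $1$. -}

module Defs where

open import Level using (0ℓ)
open import Data.Nat using (ℕ; zero; suc; ⌊_/2⌋)
import Data.Nat as N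
open import Data.Product using (_×_)
open import Data.Fin using (Fin)
open import Data.Product using (∃)
open import Relation.Nullary using (¬_)
open import Relation.Binary.PropositionalEquality using (_≡_)
open import Algebra.Bundles using (CommutativeRing)

record FiniteField (q : ℕ) : Set₁ where
  field
    cring : CommutativeRing 0ℓ 0ℓ
  open CommutativeRing cring public
  field
    1≉0      : ¬ (1# ≈ 0#)
    inverse  : ∀ x → ¬ (x ≈ 0#) → ∃ λ y → (x * y) ≈ 1#
    enum     : Fin q → Carrier
    enum-inj : ∀ i j → enum i ≈ enum j → i ≡ j
    enum-sur : ∀ x → ∃ λ i → enum i ≈ x

module _ {q : ℕ} (F : FiniteField q) where
  open FiniteField F

  ι : ℕ → Carrier
  ι zero    = 0#
  ι (suc n) = 1# + ι n

  pow : Carrier → ℕ → Carrier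
  pow x zero    = 1#
  pow x (suc n) = x * pow x n

  IsPermutation : (Carrier → Carrier) → Set
  IsPermutation f =
    (∀ x y → f x ≈ f y → x ≈ y) × (∀ y → ∃ λ x → f x ≈ y)

  -- Evaluation of the reversed Dickson polynomial D_{n,k}(1,x) of the (k+1)-th kind:
  -- D_{0,k} = 2 - k, D_{1,k} = 1, D_{n,k} = D_{n-1,k} - x D_{n-2,k}  (n ≥ 2).
  D : ℕ → ℕ → Carrier → Carrier
  D zero          k x = ι 2 - ι k
  D (suc zero)    k x = 1#
  D (suc (suc n)) k x = D (suc n) k x - (x * D n k x)

  -- The polynomial h of the theorem (as a function on F); all exponents are
  -- exact halves since p is odd (⌊_/2⌋ is ℕ floor-halving).
  h : (p k l₁ l₂ l₃ l₄ : ℕ) → Carrier → Carrier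
  h p k l₁ l₂ l₃ l₄ x =
      (c₂ * pow x ⌊ (a N.+ b N.+ c N.+ d) /2⌋)
    + (ck * (pow x ⌊ (a N.+ b N.+ c N.∸ 1) /2⌋ + pow x ⌊ (a N.+ b N.+ d N.∸ 1) /2⌋
           + pow x ⌊ (a N.+ c N.+ d N.∸ 1) /2⌋ + pow x ⌊ (b N.+ c N.+ d N.∸ 1) /2⌋))
    + (c₂ * (pow x ⌊ (a N.+ b) /2⌋ + pow x ⌊ (a N.+ c) /2⌋ + pow x ⌊ (b N.+ c) /2⌋
           + pow x ⌊ (a N.+ d) /2⌋ + pow x ⌊ (b N.+ d) /2⌋ + pow x ⌊ (c N.+ d) /2⌋))
    + (ck * (pow x ⌊ (a N.∸ 1) /2⌋ + pow x ⌊ (b N.∸ 1) /2⌋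
           + pow x ⌊ (c N.∸ 1) /2⌋ + pow x ⌊ (d N.∸ 1) /2⌋))
    where
      a = p N.^ l₁
      b = p N.^ l₂
      c = p N.^ l₃
      d = p N.^ l₄
      c₂ = ι 2 - ι k
      ck = ι k

module Submission where

-- Write N = p^l₁ + p^l₂ + p^l₃ + p^l₄ and let t = 1/2 in F
-- (p is odd, and F has characteristic p because |F| = p^e).  For any w ∈ F
-- put x = t²(1 - w) and y = t(1 + √w) in the ring F[√w] = F[X]/(X² - w).  Then
-- y² = y - x, so D_{n,k}(1,x) = L(yⁿ) for the F-linear form
-- L(a + b√w) = (2-k)a + kb, which matches D₀ = 2-k and D₁ = 1.  In
-- characteristic p the Frobenius map gives (1 + √w)^(p^l) = 1 + w^((p^l-1)/2) √w,
-- and expanding the product of the four factors yields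
--     D_{N,k}(1, t²(1 - w)) = tᴺ (2 - k + h(w)).
-- Since w ↦ t²(1 - w) and z ↦ tᴺ(2 - k + z) are bijections of F, D_{N,k}(1,x)
-- permutes F iff h does.

open import Defs

open import Level using (0ℓ)
open import Algebra.Bundles using (CommutativeRing)
open import Data.Nat as ℕ using (ℕ; zero; suc)
import Data.Nat.Properties as ℕP
open import Data.Nat.Combinatorics using (_C_; nCn≡1)
open import Data.Nat.Divisibility using (_∣_; divides)
open import Data.Nat.Primality using (Prime)
open import Data.Integer using (+_)
open import Data.Fin as Fin using (Fin; fromℕ; inject₁)
import Data.Fin.Properties as FinP
open import Data.Fin.Permutation using (permutation)
open import Data.Vec.Functional using (replicate)
open import Data.Maybe using (Maybe; just; nothing)
open import Data.Product using (_,_; proj₁; proj₂; ∃)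
import Data.Product as P
open import Data.Empty using (⊥-elim)
open import Relation.Nullary using (¬_; Dec; yes; no)
import Relation.Binary.PropositionalEquality as ≡
open import Function.Base using (_∘_)
open import Function.Bundles using (_⇔_; mk⇔)
import Function.Properties.Equivalence as ⇔

-- The ring solver with integer coefficients, valid in every commutative
-- ring R: the canonical map ℤ → R is a ring homomorphism.  Numerals are
-- interpreted so that `con (+ 0)` and `con (+ 1)` denote 0# and 1# on the nose.
module IntegerRingSolver (R : CommutativeRing 0ℓ 0ℓ) where
  open import Data.Integer as ℤ using (ℤ; -[1+_]; _⊖_; sign; ∣_∣; _◃_)
  import Data.Integer.Properties as ℤP
  open import Data.Sign as Sign using (Sign)
  open CommutativeRing R
  open import Relation.Binary.Reasoning.Setoid setoid
  open import Algebra.Properties.Ring ring using (-‿involutive; -‿distribˡ-*; -0#≈0#)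
  open import Algebra.Properties.AbelianGroup +-abelianGroup using (⁻¹-∙-comm)
  open import Algebra.Properties.Semiring.Mult semiring using (_×_; ×-homo-+; ×1-homo-*)
  open import Algebra.Solver.Ring.AlmostCommutativeRing
    using (AlmostCommutativeRing; fromCommutativeRing; _-Raw-AlmostCommutative⟶_)

  natural : ℕ → Carrier
  natural zero          = 0#
  natural (suc zero)    = 1#
  natural (suc (suc n)) = 1# + natural (suc n)

  natural≈× : ∀ n → natural n ≈ n × 1#
  natural≈× zero          = refl
  natural≈× (suc zero)    = sym (+-identityʳ 1#)
  natural≈× (suc (suc n)) = +-congˡ (natural≈× (suc n))

  natural-suc : ∀ n → natural (suc n) ≈ 1# + natural n
  natural-suc n = trans (natural≈× (suc n)) (+-congˡ (sym (natural≈× n)))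

  natural-+ : ∀ m n → natural (m ℕ.+ n) ≈ natural m + natural n
  natural-+ m n = trans (natural≈× (m ℕ.+ n))
    (trans (×-homo-+ 1# m n) (sym (+-cong (natural≈× m) (natural≈× n))))

  natural-* : ∀ m n → natural (m ℕ.* n) ≈ natural m * natural n
  natural-* m n = trans (natural≈× (m ℕ.* n))
    (trans (×1-homo-* m n) (sym (*-cong (natural≈× m) (natural≈× n))))

  integer : ℤ → Carrier
  integer (+ n)    = natural n
  integer -[1+ n ] = - natural (suc n)

  signed : Sign → Carrier
  signed Sign.+ = 1#
  signed Sign.- = - 1#

  signed-* : ∀ s t → signed (s Sign.* t) ≈ signed s * signed t
  signed-* Sign.+ t      = sym (*-identityˡ _)
  signed-* Sign.- Sign.+ = sym (*-identityʳ _)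
  signed-* Sign.- Sign.- = sym (begin
    - 1# * - 1#   ≈⟨ -‿distribˡ-* 1# (- 1#) ⟨
    - (1# * - 1#) ≈⟨ -‿cong (*-identityˡ _) ⟩
    - - 1#        ≈⟨ -‿involutive 1# ⟩
    1#            ∎)

  integer-◃ : ∀ s n → integer (s ◃ n) ≈ signed s * natural n
  integer-◃ s      zero    = sym (zeroʳ _)
  integer-◃ Sign.+ (suc n) = sym (*-identityˡ _)
  integer-◃ Sign.- (suc n) = trans (-‿cong (sym (*-identityˡ _))) (-‿distribˡ-* _ _)

  integer-sign-abs : ∀ i → integer i ≈ signed (sign i) * natural ∣ i ∣
  integer-sign-abs i =
    trans (reflexive (≡.cong integer (≡.sym (ℤP.◃-inverse i)))) (integer-◃ (sign i) ∣ i ∣)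

  cancel-one : ∀ a b → (1# + a) - (1# + b) ≈ a - b
  cancel-one a b = begin
    (1# + a) - (1# + b)       ≈⟨ +-congˡ (⁻¹-∙-comm 1# b) ⟨
    (1# + a) + (- 1# - b)     ≈⟨ +-assoc 1# a _ ⟩
    1# + (a + (- 1# - b))     ≈⟨ +-congˡ (+-assoc a (- 1#) _) ⟨
    1# + ((a - 1#) - b)       ≈⟨ +-congˡ (+-congʳ (+-comm a (- 1#))) ⟩
    1# + ((- 1# + a) - b)     ≈⟨ +-congˡ (+-assoc (- 1#) a _) ⟩
    1# + (- 1# + (a - b))     ≈⟨ +-assoc 1# (- 1#) _ ⟨
    (1# - 1#) + (a - b)       ≈⟨ +-congʳ (-‿inverseʳ 1#) ⟩
    0# + (a - b)              ≈⟨ +-identityˡ _ ⟩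
    a - b                     ∎

  integer-⊖ : ∀ m n → integer (m ⊖ n) ≈ natural m - natural n
  integer-⊖ zero    zero    = sym (trans (+-identityˡ _) -0#≈0#)
  integer-⊖ zero    (suc n) = sym (+-identityˡ _)
  integer-⊖ (suc m) zero    = sym (trans (+-congˡ -0#≈0#) (+-identityʳ _))
  integer-⊖ (suc m) (suc n) = begin
    integer (suc m ⊖ suc n)             ≡⟨ ≡.cong integer (ℤP.[1+m]⊖[1+n]≡m⊖n m n) ⟩
    integer (m ⊖ n)                     ≈⟨ integer-⊖ m n ⟩
    natural m - natural n               ≈⟨ cancel-one _ _ ⟨
    (1# + natural m) - (1# + natural n) ≈⟨ +-cong (natural-suc m) (-‿cong (natural-suc n)) ⟨
    natural (suc m) - natural (suc n)   ∎

  integer-+ : ∀ i j → integer (i ℤ.+ j) ≈ integer i + integer j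
  integer-+ (+ m)    (+ n)    = natural-+ m n
  integer-+ (+ m)    -[1+ n ] = integer-⊖ m (suc n)
  integer-+ -[1+ m ] (+ n)    = trans (integer-⊖ n (suc m)) (+-comm _ _)
  integer-+ -[1+ m ] -[1+ n ] = begin
    - natural (suc (suc (m ℕ.+ n)))       ≈⟨ -‿cong (natural-suc (suc (m ℕ.+ n))) ⟩
    - (1# + natural (suc m ℕ.+ n))        ≈⟨ -‿cong (+-congˡ (natural-+ (suc m) n)) ⟩
    - (1# + (natural (suc m) + natural n)) ≈⟨ -‿cong (+-congˡ (+-comm _ _)) ⟩
    - (1# + (natural n + natural (suc m))) ≈⟨ -‿cong (+-assoc _ _ _) ⟨
    - ((1# + natural n) + natural (suc m)) ≈⟨ -‿cong (+-cong (sym (natural-suc n)) refl) ⟩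
    - (natural (suc n) + natural (suc m)) ≈⟨ ⁻¹-∙-comm _ _ ⟨
    - natural (suc n) - natural (suc m)   ≈⟨ +-comm _ _ ⟩
    - natural (suc m) - natural (suc n)   ∎

  integer-* : ∀ i j → integer (i ℤ.* j) ≈ integer i * integer j
  integer-* i j = begin
    integer (i ℤ.* j)                              ≈⟨ integer-◃ (sign i Sign.* sign j) (∣ i ∣ ℕ.* ∣ j ∣) ⟩
    signed (sign i Sign.* sign j) * natural (∣ i ∣ ℕ.* ∣ j ∣)
      ≈⟨ *-cong (signed-* (sign i) (sign j)) (natural-* ∣ i ∣ ∣ j ∣) ⟩
    (signed (sign i) * signed (sign j)) * (natural ∣ i ∣ * natural ∣ j ∣)
      ≈⟨ interchange _ _ _ _ ⟩
    (signed (sign i) * natural ∣ i ∣) * (signed (sign j) * natural ∣ j ∣)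
      ≈⟨ *-cong (integer-sign-abs i) (integer-sign-abs j) ⟨
    integer i * integer j                          ∎
    where
    interchange : ∀ a b c d → (a * b) * (c * d) ≈ (a * c) * (b * d)
    interchange a b c d = begin
      (a * b) * (c * d) ≈⟨ *-assoc a b _ ⟩
      a * (b * (c * d)) ≈⟨ *-congˡ (*-assoc b c d) ⟨
      a * ((b * c) * d) ≈⟨ *-congˡ (*-congʳ (*-comm b c)) ⟩
      a * ((c * b) * d) ≈⟨ *-congˡ (*-assoc c b d) ⟩
      a * (c * (b * d)) ≈⟨ *-assoc a c _ ⟨
      (a * c) * (b * d) ∎

  integer-neg : ∀ i → integer (ℤ.- i) ≈ - integer i
  integer-neg (+ zero)  = sym -0#≈0#
  integer-neg (+ suc n) = refl
  integer-neg -[1+ n ]  = sym (-‿involutive _)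

  private
    ℤ-ring : AlmostCommutativeRing 0ℓ 0ℓ
    ℤ-ring = fromCommutativeRing ℤP.+-*-commutativeRing

    homomorphism : AlmostCommutativeRing.rawRing ℤ-ring -Raw-AlmostCommutative⟶ fromCommutativeRing R
    homomorphism = record
      { ⟦_⟧    = integer
      ; +-homo = integer-+
      ; *-homo = integer-*
      ; -‿homo = integer-neg
      ; 0-homo = refl
      ; 1-homo = refl
      }

    equal? : ∀ i j → Maybe (integer i ≈ integer j)
    equal? i j with i ℤ.≟ j
    ... | yes i≡j = just (reflexive (≡.cong integer i≡j))
    ... | no _    = nothing

  open import Algebra.Solver.Ring _ _ homomorphism equal? public

module PrimeBinomial where
  open import Data.Nat
  open import Data.Nat.Properties
  open import Data.Nat.Combinatorics
  open import Data.Nat.Divisibility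
  open import Data.Nat.Primality
  open import Data.Sum using (inj₁; inj₂)
  open import Relation.Binary.PropositionalEquality
  open import Data.Nat.Tactic.RingSolver

  absorption : ∀ n k → suc k * (suc n C suc k) ≡ suc n * (n C k)
  absorption zero zero = refl
  absorption zero (suc k)
    rewrite k>n⇒nCk≡0 {1} {suc (suc k)} (s≤s (s≤s z≤n)) | k>n⇒nCk≡0 {0} {suc k} (s≤s z≤n)
    = *-zeroʳ (suc (suc k))
  absorption (suc n) zero = trans (+-identityʳ _) (trans (nC1≡n (suc (suc n))) (sym (*-identityʳ _)))
  absorption (suc n) (suc k) = begin
    suc (suc k) * (suc (suc n) C suc (suc k)) ≡⟨ cong (suc (suc k) *_) (nCk+nC[k+1]≡[n+1]C[k+1] (suc n) (suc k)) ⟨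
    suc (suc k) * (A + B)                     ≡⟨ *-distribˡ-+ (suc (suc k)) A B ⟩
    (A + suc k * A) + suc (suc k) * B         ≡⟨ cong₂ (λ u v → (A + u) + v) (absorption n k) (absorption n (suc k)) ⟩
    (A + suc n * (n C k)) + suc n * (n C suc k) ≡⟨ regroup A (suc n) (n C k) (n C suc k) ⟩
    A + suc n * (n C k + n C suc k)           ≡⟨ cong (λ z → A + suc n * z) (nCk+nC[k+1]≡[n+1]C[k+1] n k) ⟩
    suc (suc n) * A                           ∎
    where
    open ≡-Reasoning
    A B : ℕ
    A = suc n C suc k
    B = suc n C suc (suc k)
    regroup : ∀ a m x y → (a + m * x) + m * y ≡ a + m * (x + y)
    regroup = solve-∀

  -- A prime p divides C(p,k) for 0 < k < p: p divides k·C(p,k) = p·C(p-1,k-1)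
  -- but not k.
  prime∣binomial : ∀ {p k} → Prime p → 0 < k → k < p → p ∣ p C k
  prime∣binomial {suc p} {suc k} p-prime _ k<p
    with euclidsLemma (suc k) (suc p C suc k) p-prime
           (divides (p C k) (trans (absorption p k) (*-comm (suc p) (p C k))))
  ... | inj₁ p∣k = ⊥-elim (<⇒≱ k<p (∣⇒≤ p∣k))
  ... | inj₂ p∣C = p∣C

open PrimeBinomial

module Frobenius (R : CommutativeRing 0ℓ 0ℓ) where
  open CommutativeRing R
  open import Relation.Binary.Reasoning.Setoid setoid
  open import Algebra.Properties.Semiring.Mult semiring using (_×_; ×-congˡ; ×-congʳ; ×-assoc-*; ×-assocˡ)
  open import Algebra.Properties.Semiring.Exp semiring using (_^_; ^-assocʳ; ^-congˡ)
  open import Algebra.Properties.Monoid.Sum +-monoid using (sum; sum-init-last; sum-cong-≋; sum-replicate-zero)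
  open import Algebra.Properties.CommutativeSemiring.Binomial commutativeSemiring
    using (binomialTerm; theorem)

  char-vanishes : ∀ p → p × 1# ≈ 0# → ∀ z → p × z ≈ 0#
  char-vanishes p char-p z = begin
    p × z        ≈⟨ ×-congʳ p (*-identityˡ z) ⟨
    p × (1# * z) ≈⟨ ×-assoc-* p 1# z ⟨
    (p × 1#) * z ≈⟨ *-congʳ char-p ⟩
    0# * z       ≈⟨ zeroˡ z ⟩
    0#           ∎

  binomial-vanishes : ∀ {p} → Prime p → p × 1# ≈ 0# →
                      ∀ {k} z → 0 ℕ.< k → k ℕ.< p → (p C k) × z ≈ 0#
  binomial-vanishes {p} p-prime char-p {k} z 0<k k<p with prime∣binomial p-prime 0<k k<p
  ... | divides m pCk≡m*p = begin
    (p C k) × z   ≡⟨ ≡.cong (_× z) (≡.trans pCk≡m*p (ℕP.*-comm m p)) ⟩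
    (p ℕ.* m) × z ≈⟨ ×-assocˡ z p m ⟨
    p × (m × z)   ≈⟨ char-vanishes p char-p (m × z) ⟩
    0#            ∎

  freshmansDream : ∀ n → (∀ {k} z → 0 ℕ.< k → k ℕ.< suc n → (suc n C k) × z ≈ 0#) →
                   ∀ x y → (x + y) ^ suc n ≈ x ^ suc n + y ^ suc n
  freshmansDream n inner-vanish x y = begin
    (x + y) ^ suc n                            ≈⟨ theorem (suc n) x y ⟩
    term Fin.zero + sum (λ i → term (Fin.suc i)) ≈⟨ +-congˡ (sum-init-last (λ i → term (Fin.suc i))) ⟩
    term Fin.zero + (sum (λ i → term (Fin.suc (inject₁ i))) + term (Fin.suc (fromℕ n)))
      ≈⟨ +-cong first-term (+-cong (sum-cong-≋ inner-terms) last-term) ⟩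
    y ^ suc n + (sum (replicate n 0#) + x ^ suc n) ≈⟨ +-congˡ (+-congʳ (sum-replicate-zero n)) ⟩
    y ^ suc n + (0# + x ^ suc n)               ≈⟨ +-congˡ (+-identityˡ _) ⟩
    y ^ suc n + x ^ suc n                      ≈⟨ +-comm _ _ ⟩
    x ^ suc n + y ^ suc n                      ∎
    where
    term : Fin (suc (suc n)) → Carrier
    term = binomialTerm x y (suc n)
    first-term : term Fin.zero ≈ y ^ suc n
    first-term = trans (+-identityʳ _) (*-identityˡ _)
    inner-terms : ∀ i → term (Fin.suc (inject₁ i)) ≈ 0#
    inner-terms i = inner-vanish _ (ℕ.s≤s ℕ.z≤n)
      (ℕ.s≤s (≡.subst (ℕ._< n) (≡.sym (FinP.toℕ-inject₁ i)) (FinP.toℕ<n i)))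
    last-term : term (Fin.suc (fromℕ n)) ≈ x ^ suc n
    last-term rewrite FinP.toℕ-fromℕ n = begin
      (suc n C suc n) × (x ^ suc n * y ^ (n ℕ.∸ n)) ≈⟨ ×-congˡ (nCn≡1 (suc n)) ⟩
      1 × (x ^ suc n * y ^ (n ℕ.∸ n))              ≈⟨ +-identityʳ _ ⟩
      x ^ suc n * y ^ (n ℕ.∸ n)                    ≡⟨ ≡.cong (λ m → x ^ suc n * y ^ m) (ℕP.n∸n≡0 n) ⟩
      x ^ suc n * 1#                             ≈⟨ *-identityʳ _ ⟩
      x ^ suc n                                  ∎

  frobenius : ∀ {p} → Prime p → p × 1# ≈ 0# → ∀ x y → (x + y) ^ p ≈ x ^ p + y ^ p
  frobenius {suc n} p-prime char-p = freshmansDream n (binomial-vanishes p-prime char-p)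

  frobenius-iterated : ∀ {p} → Prime p → p × 1# ≈ 0# →
                       ∀ l x y → (x + y) ^ (p ℕ.^ l) ≈ x ^ (p ℕ.^ l) + y ^ (p ℕ.^ l)
  frobenius-iterated {p} p-prime char-p zero x y =
    trans (*-identityʳ _) (sym (+-cong (*-identityʳ x) (*-identityʳ y)))
  frobenius-iterated {p} p-prime char-p (suc l) x y = begin
    (x + y) ^ (p ℕ.* p ℕ.^ l)         ≈⟨ ^-assocʳ (x + y) p (p ℕ.^ l) ⟨
    ((x + y) ^ p) ^ (p ℕ.^ l)         ≈⟨ ^-congˡ (p ℕ.^ l) (frobenius p-prime char-p x y) ⟩
    (x ^ p + y ^ p) ^ (p ℕ.^ l)       ≈⟨ frobenius-iterated p-prime char-p l (x ^ p) (y ^ p) ⟩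
    (x ^ p) ^ (p ℕ.^ l) + (y ^ p) ^ (p ℕ.^ l) ≈⟨ +-cong (^-assocʳ x p _) (^-assocʳ y p _) ⟩
    x ^ (p ℕ.* p ℕ.^ l) + y ^ (p ℕ.* p ℕ.^ l) ∎

module Parity where
  open import Data.Nat
  open import Data.Nat.Properties using (+-suc)
  open import Data.Nat.Divisibility using (∣m∣n⇒∣m+n; ∣-refl)
  open import Relation.Binary.PropositionalEquality
  open import Data.Nat.Tactic.RingSolver

  record Odd (n α : ℕ) : Set where
    constructor odd
    field n≡2α+1 : n ≡ suc (α + α)

  odd-half : ∀ n → ¬ 2 ∣ n → ∃ (Odd n)
  odd-half zero          2∤n = ⊥-elim (2∤n (divides 0 refl))
  odd-half (suc zero)    2∤n = 0 , odd refl
  odd-half (suc (suc n)) 2∤n with odd-half n (λ 2∣n → 2∤n (∣m∣n⇒∣m+n ∣-refl 2∣n))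
  ... | α , odd refl = suc α , odd (cong (λ m → suc (suc m)) (sym (+-suc α α)))

  odd-power : ∀ {p α} → Odd p α → ∀ l → ∃ (Odd (p ^ l))
  odd-power p-odd               zero    = 0 , odd refl
  odd-power {α = α} (odd refl) (suc l) with odd-power (odd {α = α} refl) l
  ... | β , odd pˡ≡2β+1 = α + β + 2 * α * β , odd (trans (cong (suc (α + α) *_) pˡ≡2β+1) (product α β))
    where
    product : ∀ a b → suc (a + a) * suc (b + b) ≡ suc ((a + b + 2 * a * b) + (a + b + 2 * a * b))
    product = solve-∀

  halve : ∀ {n} s → n ≡ s + s → ⌊ n /2⌋ ≡ s
  halve zero    refl = refl
  halve (suc s) refl rewrite +-suc s s = cong suc (halve s refl)

  module HalfExponents {a b c d α β γ δ : ℕ}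
                       (oa : Odd a α) (ob : Odd b β) (oc : Odd c γ) (od : Odd d δ) where

    half₁ : ⌊ (a ∸ 1) /2⌋ ≡ α
    half₁ rewrite Odd.n≡2α+1 oa = halve α refl

    half₂ : ⌊ (a + b) /2⌋ ≡ suc (α + β)
    half₂ rewrite Odd.n≡2α+1 oa | Odd.n≡2α+1 ob = halve (suc (α + β)) (lemma α β)
      where
      lemma : ∀ α β → suc (α + α) + suc (β + β) ≡ suc (α + β) + suc (α + β)
      lemma = solve-∀

    half₃ : ⌊ (a + b + c ∸ 1) /2⌋ ≡ suc (α + β + γ)
    half₃ rewrite Odd.n≡2α+1 oa | Odd.n≡2α+1 ob | Odd.n≡2α+1 oc =
      halve (suc (α + β + γ)) (lemma α β γ)
      where
      lemma : ∀ α β γ → α + α + suc (β + β) + suc (γ + γ) ≡ suc (α + β + γ) + suc (α + β + γ)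
      lemma = solve-∀

    half₄ : ⌊ (a + b + c + d) /2⌋ ≡ suc (suc (α + β + γ + δ))
    half₄ rewrite Odd.n≡2α+1 oa | Odd.n≡2α+1 ob | Odd.n≡2α+1 oc | Odd.n≡2α+1 od =
      halve (suc (suc (α + β + γ + δ))) (lemma α β γ δ)
      where
      lemma : ∀ α β γ δ → suc (α + α) + suc (β + β) + suc (γ + γ) + suc (δ + δ)
                        ≡ suc (suc (α + β + γ + δ)) + suc (suc (α + β + γ + δ))
      lemma = solve-∀

open Parity

-- Polynomial expressions written once over an arbitrary carrier with + and *:
-- instantiated with the ring solver's syntax they can be normalised, and
-- instantiated with a ring's operations they are the terms occurring below.
module Expressions {A : Set} (plus times : A → A → A) (one : A) where
  private
    infixl 6 _+_
    infixl 7 _*_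
    _+_ _*_ : A → A → A
    _+_ = plus
    _*_ = times

  pairMul : A → A P.× A → A P.× A → A P.× A
  pairMul w (a , b) (c , d) = (a * c + w * (b * d) , a * d + b * c)

  linear : A → A → A P.× A → A
  linear c K (a , b) = c * a + K * b

  fourProduct : (w a b c d : A) → A P.× A
  fourProduct w a b c d =
    pairMul w (pairMul w (pairMul w (one , a) (one , b)) (one , c)) (one , d)

  -- the polynomial h of the theorem, written in terms of w and the four
  -- values a, b, c, d standing for w^((p^lᵢ-1)/2)
  hExpr : (c K w a b c d : A) → A
  hExpr c₂ K w a b c d =
      c₂ * (w * (w * (a * b * c * d)))
    + K * (w * (a * b * c) + w * (a * b * d) + w * (a * c * d) + w * (b * c * d))
    + c₂ * (w * (a * b) + w * (a * c) + w * (b * c) + w * (a * d) + w * (b * d) + w * (c * d))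
    + K * (a + b + c + d)

-- The ring R[√w] = R[X]/(X² - w) for an element w of a commutative ring R,
-- represented by pairs (a , b) = a + b√w.
module QuadraticExtension (R : CommutativeRing 0ℓ 0ℓ) (w : CommutativeRing.Carrier R) where
  open CommutativeRing R
  open IntegerRingSolver R using (solve; _:+_; _:*_; _:=_; con)

  infix  4 _≋_
  infixl 6 _⊕_
  infixl 7 _⊗_

  Pair : Set
  Pair = Carrier P.× Carrier

  _≋_ : Pair → Pair → Set
  (a , b) ≋ (c , d) = (a ≈ c) P.× (b ≈ d)

  _⊕_ _⊗_ : Pair → Pair → Pair
  (a , b) ⊕ (c , d) = (a + c , b + d)
  _⊗_ = Expressions.pairMul _+_ _*_ 1# w

  ⊖_ : Pair → Pair
  ⊖ (a , b) = (- a , - b)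

  R[√w] : CommutativeRing 0ℓ 0ℓ
  R[√w] = record
    { Carrier = Pair ; _≈_ = _≋_ ; _+_ = _⊕_ ; _*_ = _⊗_ ; -_ = ⊖_
    ; 0# = (0# , 0#) ; 1# = (1# , 0#)
    ; isCommutativeRing = record
      { isRing = record
        { +-isAbelianGroup = record
          { isGroup = record
            { isMonoid = record
              { isSemigroup = record
                { isMagma = record
                  { isEquivalence = record
                    { refl  = refl , refl
                    ; sym   = λ (e , f) → sym e , sym f
                    ; trans = λ (e , f) (e′ , f′) → trans e e′ , trans f f′ }
                  ; ∙-cong = λ (e , f) (e′ , f′) → +-cong e e′ , +-cong f f′ }
                ; assoc = λ _ _ _ → +-assoc _ _ _ , +-assoc _ _ _ }
              ; identity = (λ _ → +-identityˡ _ , +-identityˡ _) , (λ _ → +-identityʳ _ , +-identityʳ _) }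
            ; inverse = (λ _ → -‿inverseˡ _ , -‿inverseˡ _) , (λ _ → -‿inverseʳ _ , -‿inverseʳ _)
            ; ⁻¹-cong = λ (e , f) → -‿cong e , -‿cong f }
          ; comm = λ _ _ → +-comm _ _ , +-comm _ _ }
        ; *-cong = λ (e , f) (e′ , f′) →
            +-cong (*-cong e e′) (*-congˡ (*-cong f f′)) , +-cong (*-cong e f′) (*-cong f e′)
        ; *-assoc = λ (a , b) (c , d) (e , f) →
            solve 7 (λ a b c d e f w →
                (a :* c :+ w :* (b :* d)) :* e :+ w :* ((a :* d :+ b :* c) :* f)
              := a :* (c :* e :+ w :* (d :* f)) :+ w :* (b :* (c :* f :+ d :* e))) refl a b c d e f w
          , solve 7 (λ a b c d e f w →
                (a :* c :+ w :* (b :* d)) :* f :+ (a :* d :+ b :* c) :* e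
              := a :* (c :* f :+ d :* e) :+ b :* (c :* e :+ w :* (d :* f))) refl a b c d e f w
        ; *-identity =
            (λ (a , b) → trans (+-cong (*-identityˡ a) (trans (*-congˡ (zeroˡ b)) (zeroʳ w))) (+-identityʳ a)
                       , trans (+-cong (*-identityˡ b) (zeroˡ a)) (+-identityʳ b))
          , (λ (a , b) → trans (+-cong (*-identityʳ a) (trans (*-congˡ (zeroʳ b)) (zeroʳ w))) (+-identityʳ a)
                       , trans (+-cong (zeroʳ a) (*-identityʳ b)) (+-identityˡ b))
        ; distrib =
            (λ (a , b) (c , d) (e , f) →
                solve 7 (λ a b c d e f w →
                    a :* (c :+ e) :+ w :* (b :* (d :+ f))
                  := (a :* c :+ w :* (b :* d)) :+ (a :* e :+ w :* (b :* f))) refl a b c d e f w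
              , solve 6 (λ a b c d e f →
                    a :* (d :+ f) :+ b :* (c :+ e) := (a :* d :+ b :* c) :+ (a :* f :+ b :* e)) refl a b c d e f)
          , (λ (a , b) (c , d) (e , f) →
                solve 7 (λ a b c d e f w →
                    (c :+ e) :* a :+ w :* ((d :+ f) :* b)
                  := (c :* a :+ w :* (d :* b)) :+ (e :* a :+ w :* (f :* b))) refl a b c d e f w
              , solve 6 (λ a b c d e f →
                    (c :+ e) :* b :+ (d :+ f) :* a := (c :* b :+ d :* a) :+ (e :* b :+ f :* a)) refl a b c d e f)
        }
      ; *-comm = λ (a , b) (c , d) →
          solve 5 (λ a b c d w → a :* c :+ w :* (b :* d) := c :* a :+ w :* (d :* b)) refl a b c d w
        , solve 4 (λ a b c d → a :* d :+ b :* c := c :* b :+ d :* a) refl a b c d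
      }
    }

  open import Algebra.Properties.Semiring.Exp semiring using (_^_)
  open import Algebra.Properties.Semiring.Mult semiring using (_×_)
  module Ext = CommutativeRing R[√w]
  open import Algebra.Properties.Semiring.Exp Ext.semiring
    using () renaming (_^_ to _^ᴱ_; ^-congˡ to ^ᴱ-congˡ) public
  open import Algebra.Properties.Semiring.Mult Ext.semiring using () renaming (_×_ to _×ᴱ_)

  embed : Carrier → Pair
  embed a = (a , 0#)

  √w : Pair
  √w = (0# , 1#)

  embed-^ : ∀ a n → embed a ^ᴱ n ≋ embed (a ^ n)
  embed-^ a zero    = refl , refl
  embed-^ a (suc n) with embed-^ a n
  ... | fst≈ , snd≈ =
      trans (+-cong (*-congˡ fst≈) (trans (*-congˡ (zeroˡ _)) (zeroʳ w))) (+-identityʳ _)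
    , trans (+-cong (trans (*-congˡ snd≈) (zeroʳ a)) (zeroˡ _)) (+-identityʳ 0#)

  embed-× : ∀ n → n ×ᴱ Ext.1# ≋ embed (n × 1#)
  embed-× zero    = refl , refl
  embed-× (suc n) = +-congˡ (proj₁ (embed-× n)) , trans (+-congˡ (proj₂ (embed-× n))) (+-identityˡ 0#)

  √w-square : ∀ a b → √w ⊗ (√w ⊗ (a , b)) ≋ (w * a , w * b)
  √w-square a b =
      solve 3 (λ w a b → con (+ 0) :* (con (+ 0) :* a :+ w :* (con (+ 1) :* b))
                        :+ w :* (con (+ 1) :* (con (+ 0) :* b :+ con (+ 1) :* a)) := w :* a) refl w a b
    , solve 3 (λ w a b → con (+ 0) :* (con (+ 0) :* b :+ con (+ 1) :* a)
                        :+ con (+ 1) :* (con (+ 0) :* a :+ w :* (con (+ 1) :* b)) := w :* b) refl w a b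

  √w-even-power : ∀ j → √w ^ᴱ (j ℕ.+ j) ≋ embed (w ^ j)
  √w-even-power zero    = refl , refl
  √w-even-power (suc j) rewrite ℕP.+-suc j j with √w-even-power j
  ... | fst≈ , snd≈ = Ext.trans (√w-square _ _) (*-congˡ fst≈ , trans (*-congˡ snd≈) (zeroʳ w))

  √w-odd-power : ∀ j → √w ^ᴱ suc (j ℕ.+ j) ≋ (0# , w ^ j)
  √w-odd-power j = Ext.trans (Ext.*-congˡ (√w-even-power j))
      ( solve 2 (λ w z → con (+ 0) :* z :+ w :* (con (+ 1) :* con (+ 0)) := con (+ 0)) refl w (w ^ j)
      , solve 1 (λ z → con (+ 0) :* con (+ 0) :+ con (+ 1) :* z := z) refl (w ^ j))

  1-^ : ∀ n → Ext.1# ^ᴱ n ≋ Ext.1#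
  1-^ zero    = Ext.refl
  1-^ (suc n) = Ext.trans (Ext.*-congˡ (1-^ n)) (Ext.*-identityˡ Ext.1#)

  1+√w-^ : ∀ {p} → Prime p → p × 1# ≈ 0# →
           ∀ l j → Odd (p ℕ.^ l) j → (1# , 1#) ^ᴱ (p ℕ.^ l) ≋ (1# , w ^ j)
  1+√w-^ {p} p-prime char-p l j (odd pˡ≡2j+1) = begin
    (1# , 1#) ^ᴱ (p ℕ.^ l)           ≈⟨ ^ᴱ-congˡ (p ℕ.^ l) (sym (+-identityʳ 1#) , sym (+-identityˡ 1#)) ⟩
    (Ext.1# ⊕ √w) ^ᴱ (p ℕ.^ l)       ≈⟨ Frobenius.frobenius-iterated R[√w] p-prime char-ext l Ext.1# √w ⟩
    Ext.1# ^ᴱ (p ℕ.^ l) ⊕ √w ^ᴱ (p ℕ.^ l) ≈⟨ Ext.+-cong (1-^ (p ℕ.^ l)) (Ext.reflexive (≡.cong (√w ^ᴱ_) pˡ≡2j+1)) ⟩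
    Ext.1# ⊕ √w ^ᴱ suc (j ℕ.+ j)     ≈⟨ Ext.+-congˡ (√w-odd-power j) ⟩
    (1# + 0# , 0# + w ^ j)           ≈⟨ +-identityʳ 1# , +-identityˡ _ ⟩
    (1# , w ^ j)                     ∎
    where
    open import Relation.Binary.Reasoning.Setoid Ext.setoid
    char-ext : p ×ᴱ Ext.1# ≋ Ext.0#
    char-ext = Ext.trans (embed-× p) (char-p , refl)

module Characteristic {q : ℕ} (F : FiniteField q) where
  open FiniteField F
  open import Relation.Binary.Reasoning.Setoid setoid
  open import Algebra.Properties.Semiring.Mult semiring using (_×_; ×1-homo-*)
  open import Algebra.Properties.Semiring.Exp semiring using (_^_)
  open import Algebra.Properties.CommutativeMonoid.Sum +-commutativeMonoid
    using (sum; sum-permute; sum-cong-≋; ∑-distrib-+; sum-replicate)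
  open import Algebra.Properties.Group +-group using (identityʳ-unique)

  index : Carrier → Fin q
  index x = proj₁ (enum-sur x)

  enum-index : ∀ x → enum (index x) ≈ x
  enum-index x = proj₂ (enum-sur x)

  _≟_ : ∀ x y → Dec (x ≈ y)
  x ≟ y with index x Fin.≟ index y
  ... | yes i≡j = yes (trans (sym (enum-index x)) (trans (reflexive (≡.cong enum i≡j)) (enum-index y)))
  ... | no  i≢j = no λ x≈y → i≢j (enum-inj _ _ (trans (enum-index x) (trans x≈y (sym (enum-index y)))))

  -- translating by a constant c permutes the elements, so
  -- Σ x = Σ (x + c) = Σ x + q·c, whence q·c = 0
  size-annihilates : ∀ c → q × c ≈ 0#
  size-annihilates c = identityʳ-unique total (q × c) (sym (begin
    total                        ≈⟨ sum-permute enum (permutation shift unshift shift-unshift unshift-shift) ⟩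
    sum (λ i → enum (shift i))   ≈⟨ sum-cong-≋ (λ i → enum-index (enum i + c)) ⟩
    sum (λ i → enum i + c)       ≈⟨ ∑-distrib-+ enum (λ _ → c) ⟩
    total + sum {q} (λ _ → c)    ≈⟨ +-congˡ (sum-replicate q) ⟩
    total + q × c                ∎))
    where
    total : Carrier
    total = sum enum
    shift unshift : Fin q → Fin q
    shift   i = index (enum i + c)
    unshift i = index (enum i - c)
    cancel : ∀ x → (x - c) + c ≈ x
    cancel x = trans (+-assoc _ _ _) (trans (+-congˡ (-‿inverseˡ c)) (+-identityʳ x))
    cancel′ : ∀ x → (x + c) - c ≈ x
    cancel′ x = trans (+-assoc _ _ _) (trans (+-congˡ (-‿inverseʳ c)) (+-identityʳ x))
    shift-unshift : ∀ i → shift (unshift i) ≡.≡ i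
    shift-unshift i = enum-inj _ _ (trans (enum-index _) (trans (+-congʳ (enum-index _)) (cancel (enum i))))
    unshift-shift : ∀ i → unshift (shift i) ≡.≡ i
    unshift-shift i = enum-inj _ _ (trans (enum-index _) (trans (+-congʳ (enum-index _)) (cancel′ (enum i))))

  nonzero-power : ∀ z → ¬ z ≈ 0# → ∀ n → ¬ z ^ n ≈ 0#
  nonzero-power z z≉0 zero    1≈0 = 1≉0 1≈0
  nonzero-power z z≉0 (suc n) zⁿ⁺¹≈0 with inverse z z≉0
  ... | u , zu≈1 = nonzero-power z z≉0 n (begin
    z ^ n            ≈⟨ *-identityˡ _ ⟨
    1# * z ^ n       ≈⟨ *-congʳ (trans (*-comm u z) zu≈1) ⟨
    (u * z) * z ^ n  ≈⟨ *-assoc u z _ ⟩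
    u * (z * z ^ n)  ≈⟨ *-congˡ zⁿ⁺¹≈0 ⟩
    u * 0#           ≈⟨ zeroʳ u ⟩
    0#               ∎)

  nilpotent⇒zero : ∀ z n → z ^ suc n ≈ 0# → z ≈ 0#
  nilpotent⇒zero z n zⁿ⁺¹≈0 with z ≟ 0#
  ... | yes z≈0 = z≈0
  ... | no  z≉0 = ⊥-elim (nonzero-power z z≉0 (suc n) zⁿ⁺¹≈0)

  ×1-^ : ∀ p e → (p ℕ.^ e) × 1# ≈ (p × 1#) ^ e
  ×1-^ p zero    = +-identityʳ 1#
  ×1-^ p (suc e) = trans (×1-homo-* p (p ℕ.^ e)) (*-congˡ (×1-^ p e))

  characteristic : ∀ p e → q ≡.≡ p ℕ.^ suc e → p × 1# ≈ 0#
  characteristic p e ≡.refl =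
    nilpotent⇒zero (p × 1#) e (trans (sym (×1-^ p (suc e))) (size-annihilates 1#))

module DicksonClosedForm {q : ℕ} (F : FiniteField q) where
  open FiniteField F
  open IntegerRingSolver cring using (Polynomial; solve; _:+_; _:*_; _:-_; _:=_; con)
  open import Algebra.Properties.Semiring.Exp semiring using (_^_)
  open import Algebra.Properties.Semiring.Mult semiring using (_×_)
  open Expressions _+_ _*_ 1# using (linear; fourProduct; hExpr)
  open module Syntax {m} = Expressions {Polynomial m} _:+_ _:*_ (con (+ 1))
    using () renaming (linear to :linear; pairMul to :pairMul; fourProduct to :fourProduct; hExpr to :hExpr)

  D-cong : ∀ n k {a b} → a ≈ b → D F n k a ≈ D F n k b
  D-cong n k {a} {b} a≈b = proj₁ (both n)
    where
    both : ∀ n → D F n k a ≈ D F n k b P.× D F (suc n) k a ≈ D F (suc n) k b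
    both zero    = refl , refl
    both (suc n) with both n
    ... | Dₙ≈ , Dₙ₊₁≈ = Dₙ₊₁≈ , +-cong Dₙ₊₁≈ (-‿cong (*-cong a≈b Dₙ≈))

  -- Fix w and t = 1/2.  With y = t(1 + √w) and x = t²(1 - w) = y·ȳ, y is a
  -- root of Y² - Y + x, so D_{n,k}(1,x) = L(yⁿ) for the linear form
  -- L(a + b√w) = (2-k)a + kb matching the initial values D₀ = 2-k, D₁ = 1.
  module _ (k : ℕ) (w t : Carrier) (t+t≈1 : t + t ≈ 1#) where
    open QuadraticExtension cring w
    open import Algebra.Properties.Semiring.Exp Ext.semiring using () renaming (^-homo-* to ^ᴱ-homo-*)
    open import Algebra.Properties.CommutativeSemiring.Exp Ext.commutativeSemiring
      using () renaming (^-distrib-* to ^ᴱ-distrib-*)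

    c₂ ck : Carrier
    c₂ = ι F 2 - ι F k
    ck = ι F k

    L : Pair → Carrier
    L = linear c₂ ck

    x : Carrier
    x = t * t * (1# - w)

    y : Pair
    y = (t , t)

    -- L(y²u) - L(yu) + x L(u) = (2t - 1) L(yu), and 2t - 1 = 0
    recurrence : ∀ u → L (y ⊗ (y ⊗ u)) ≈ L (y ⊗ u) - x * L u
    recurrence (f , s) = begin
      L (y ⊗ (y ⊗ (f , s)))                                        ≈⟨ defect ⟩
      (L (y ⊗ (f , s)) - x * L (f , s)) + ((t + t) - 1#) * L (y ⊗ (f , s)) ≈⟨ +-congˡ (*-congʳ 2t-1≈0) ⟩
      (L (y ⊗ (f , s)) - x * L (f , s)) + 0# * L (y ⊗ (f , s))     ≈⟨ +-congˡ (zeroˡ _) ⟩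
      (L (y ⊗ (f , s)) - x * L (f , s)) + 0#                       ≈⟨ +-identityʳ _ ⟩
      L (y ⊗ (f , s)) - x * L (f , s)                              ∎
      where
      open import Relation.Binary.Reasoning.Setoid setoid
      2t-1≈0 : (t + t) - 1# ≈ 0#
      2t-1≈0 = trans (+-congʳ t+t≈1) (-‿inverseʳ 1#)
      defect : L (y ⊗ (y ⊗ (f , s))) ≈ (L (y ⊗ (f , s)) - x * L (f , s)) + ((t + t) - 1#) * L (y ⊗ (f , s))
      defect = solve 6 (λ c K w t f s →
          :linear c K (:pairMul w (t , t) (:pairMul w (t , t) (f , s)))
        := (:linear c K (:pairMul w (t , t) (f , s)) :- (t :* t :* (con (+ 1) :- w)) :* :linear c K (f , s))
           :+ ((t :+ t) :- con (+ 1)) :* :linear c K (:pairMul w (t , t) (f , s))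
        ) refl c₂ ck w t f s

    dickson-closed-form : ∀ n → D F n k x ≈ L (y ^ᴱ n)
    dickson-closed-form n = proj₁ (both n)
      where
      both : ∀ n → D F n k x ≈ L (y ^ᴱ n) P.× D F (suc n) k x ≈ L (y ^ᴱ suc n)
      both zero = solve 2 (λ c K → c := :linear c K (con (+ 1) , con (+ 0))) refl c₂ ck
                , trans (sym t+t≈1) (solve 3 (λ K w t →
                    t :+ t := :linear ((con (+ 1) :+ (con (+ 1) :+ con (+ 0))) :- K) K
                                     (:pairMul w (t , t) (con (+ 1) , con (+ 0)))) refl ck w t)
      both (suc n) with both n
      ... | Dₙ≈ , Dₙ₊₁≈ = Dₙ₊₁≈ , trans (+-cong Dₙ₊₁≈ (-‿cong (*-congˡ Dₙ≈))) (sym (recurrence (y ^ᴱ n)))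

    L-cong : ∀ {u v} → u ≋ v → L u ≈ L v
    L-cong (a≈ , b≈) = +-cong (*-congˡ a≈) (*-congˡ b≈)

    L-scalar : ∀ a u → L (embed a ⊗ u) ≈ a * L u
    L-scalar a (f , s) = solve 6 (λ c K w a f s →
        :linear c K (:pairMul w (a , con (+ 0)) (f , s)) := a :* :linear c K (f , s)) refl c₂ ck w a f s

    y-factor : y ≋ embed t ⊗ (1# , 1#)
    y-factor = solve 2 (λ w t → t := t :* con (+ 1) :+ w :* (con (+ 0) :* con (+ 1))) refl w t
             , solve 1 (λ t → t := t :* con (+ 1) :+ con (+ 0) :* con (+ 1)) refl t

    L-fourProduct : ∀ a b c d →
      L (fourProduct w a b c d) ≈ c₂ + hExpr c₂ ck w a b c d
    L-fourProduct a b c d = solve 7 (λ c₂ K w a b c d →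
        :linear c₂ K (:fourProduct w a b c d) := c₂ :+ :hExpr c₂ K w a b c d) refl c₂ ck w a b c d

    -- Evaluation at N = p^l₁ + p^l₂ + p^l₃ + p^l₄ in characteristic p, where
    -- p^lᵢ = 2αᵢ + 1: each factor (1 + √w)^(p^lᵢ) is 1 + w^αᵢ √w by Frobenius.
    module _ {p : ℕ} (p-prime : Prime p) (char-p : p × 1# ≈ 0#)
             (l₁ l₂ l₃ l₄ α₁ α₂ α₃ α₄ : ℕ)
             (o₁ : Odd (p ℕ.^ l₁) α₁) (o₂ : Odd (p ℕ.^ l₂) α₂)
             (o₃ : Odd (p ℕ.^ l₃) α₃) (o₄ : Odd (p ℕ.^ l₄) α₄) where

      N : ℕ
      N = p ℕ.^ l₁ ℕ.+ p ℕ.^ l₂ ℕ.+ p ℕ.^ l₃ ℕ.+ p ℕ.^ l₄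

      1+√w-^N : (1# , 1#) ^ᴱ N ≋ fourProduct w (w ^ α₁) (w ^ α₂) (w ^ α₃) (w ^ α₄)
      1+√w-^N = begin
        U ^ᴱ N                                                ≈⟨ ^ᴱ-homo-* U (p ℕ.^ l₁ ℕ.+ p ℕ.^ l₂ ℕ.+ p ℕ.^ l₃) (p ℕ.^ l₄) ⟩
        U ^ᴱ (p ℕ.^ l₁ ℕ.+ p ℕ.^ l₂ ℕ.+ p ℕ.^ l₃) ⊗ U ^ᴱ p ℕ.^ l₄ ≈⟨ Ext.*-congʳ (^ᴱ-homo-* U (p ℕ.^ l₁ ℕ.+ p ℕ.^ l₂) (p ℕ.^ l₃)) ⟩
        (U ^ᴱ (p ℕ.^ l₁ ℕ.+ p ℕ.^ l₂) ⊗ U ^ᴱ p ℕ.^ l₃) ⊗ U ^ᴱ p ℕ.^ l₄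
          ≈⟨ Ext.*-congʳ (Ext.*-congʳ (^ᴱ-homo-* U (p ℕ.^ l₁) (p ℕ.^ l₂))) ⟩
        ((U ^ᴱ p ℕ.^ l₁ ⊗ U ^ᴱ p ℕ.^ l₂) ⊗ U ^ᴱ p ℕ.^ l₃) ⊗ U ^ᴱ p ℕ.^ l₄
          ≈⟨ Ext.*-cong (Ext.*-cong (Ext.*-cong (power l₁ α₁ o₁) (power l₂ α₂ o₂)) (power l₃ α₃ o₃)) (power l₄ α₄ o₄) ⟩
        fourProduct w (w ^ α₁) (w ^ α₂) (w ^ α₃) (w ^ α₄)     ∎
        where
        open import Relation.Binary.Reasoning.Setoid Ext.setoid
        U : Pair
        U = (1# , 1#)
        power : ∀ l α → Odd (p ℕ.^ l) α → U ^ᴱ (p ℕ.^ l) ≋ (1# , w ^ α)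
        power = 1+√w-^ p-prime char-p

      dickson-at-sum : D F N k x ≈ t ^ N * (c₂ + hExpr c₂ ck w (w ^ α₁) (w ^ α₂) (w ^ α₃) (w ^ α₄))
      dickson-at-sum = begin
        D F N k x                              ≈⟨ dickson-closed-form N ⟩
        L (y ^ᴱ N)                             ≈⟨ L-cong (^ᴱ-congˡ N y-factor) ⟩
        L ((embed t ⊗ (1# , 1#)) ^ᴱ N)         ≈⟨ L-cong (^ᴱ-distrib-* (embed t) (1# , 1#) N) ⟩
        L (embed t ^ᴱ N ⊗ (1# , 1#) ^ᴱ N)      ≈⟨ L-cong (Ext.*-cong (embed-^ t N) 1+√w-^N) ⟩
        L (embed (t ^ N) ⊗ fourProduct w _ _ _ _) ≈⟨ L-scalar (t ^ N) _ ⟩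
        t ^ N * L (fourProduct w _ _ _ _)      ≈⟨ *-congˡ (L-fourProduct _ _ _ _) ⟩
        t ^ N * (c₂ + hExpr c₂ ck w _ _ _ _)   ∎
        where open import Relation.Binary.Reasoning.Setoid setoid

module HalfPowerForm {q : ℕ} (F : FiniteField q) where
  open FiniteField F
  open import Algebra.Properties.Semiring.Exp semiring using (_^_; ^-homo-*)
  open Expressions _+_ _*_ 1# using (hExpr)

  pow≈^ : ∀ x n → pow F x n ≈ x ^ n
  pow≈^ x zero    = refl
  pow≈^ x (suc n) = *-congˡ (pow≈^ x n)

  module _ (p k l₁ l₂ l₃ l₄ α₁ α₂ α₃ α₄ : ℕ)
           (o₁ : Odd (p ℕ.^ l₁) α₁) (o₂ : Odd (p ℕ.^ l₂) α₂)
           (o₃ : Odd (p ℕ.^ l₃) α₃) (o₄ : Odd (p ℕ.^ l₄) α₄) (w : Carrier) where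

    private
      pow-at : ∀ {m n} → m ≡.≡ n → pow F w m ≈ w ^ n
      pow-at {m} ≡.refl = pow≈^ w m

      ^-+ : ∀ m n → w ^ (m ℕ.+ n) ≈ w ^ m * w ^ n
      ^-+ = ^-homo-* w

      one : ∀ {a α} → Odd a α → pow F w ℕ.⌊ (a ℕ.∸ 1) /2⌋ ≈ w ^ α
      one oa = pow-at (HalfExponents.half₁ oa oa oa oa)

      two : ∀ {a b α β} → Odd a α → Odd b β → pow F w ℕ.⌊ (a ℕ.+ b) /2⌋ ≈ w * (w ^ α * w ^ β)
      two {α = α} {β} oa ob = trans (pow-at (HalfExponents.half₂ oa ob oa oa)) (*-congˡ (^-+ α β))

      three : ∀ {a b c α β γ} → Odd a α → Odd b β → Odd c γ →
              pow F w ℕ.⌊ (a ℕ.+ b ℕ.+ c ℕ.∸ 1) /2⌋ ≈ w * (w ^ α * w ^ β * w ^ γ)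
      three {α = α} {β} {γ} oa ob oc = trans (pow-at (HalfExponents.half₃ oa ob oc oa))
        (*-congˡ (trans (^-+ (α ℕ.+ β) γ) (*-congʳ (^-+ α β))))

      four : pow F w ℕ.⌊ (p ℕ.^ l₁ ℕ.+ p ℕ.^ l₂ ℕ.+ p ℕ.^ l₃ ℕ.+ p ℕ.^ l₄) /2⌋
             ≈ w * (w * (w ^ α₁ * w ^ α₂ * w ^ α₃ * w ^ α₄))
      four = trans (pow-at (HalfExponents.half₄ o₁ o₂ o₃ o₄))
        (*-congˡ (*-congˡ (trans (^-+ (α₁ ℕ.+ α₂ ℕ.+ α₃) α₄)
          (*-congʳ (trans (^-+ (α₁ ℕ.+ α₂) α₃) (*-congʳ (^-+ α₁ α₂)))))))

    h-as-hExpr : h F p k l₁ l₂ l₃ l₄ w ≈ hExpr (ι F 2 - ι F k) (ι F k) w (w ^ α₁) (w ^ α₂) (w ^ α₃) (w ^ α₄)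
    h-as-hExpr =
      +-cong (+-cong (+-cong
        (*-congˡ four)
        (*-congˡ (+-cong (+-cong (+-cong (three o₁ o₂ o₃) (three o₁ o₂ o₄)) (three o₁ o₃ o₄)) (three o₂ o₃ o₄))))
        (*-congˡ (+-cong (+-cong (+-cong (+-cong (+-cong
          (two o₁ o₂) (two o₁ o₃)) (two o₂ o₃)) (two o₁ o₄)) (two o₂ o₄)) (two o₃ o₄))))
        (*-congˡ (+-cong (+-cong (+-cong (one o₁) (one o₂)) (one o₃)) (one o₄)))

module PermutationTransfer {q : ℕ} (F : FiniteField q) where
  open FiniteField F
  open IntegerRingSolver cring using (solve; _:+_; _:*_; _:-_; _:=_; con)

  Congruent : (Carrier → Carrier) → Set
  Congruent f = ∀ {a b} → a ≈ b → f a ≈ f b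

  record Invertible (φ : Carrier → Carrier) : Set where
    field
      φ⁻¹        : Carrier → Carrier
      φ-cong     : Congruent φ
      φ⁻¹-cong   : Congruent φ⁻¹
      φ⁻¹∘φ≈id   : ∀ x → φ⁻¹ (φ x) ≈ x
      φ∘φ⁻¹≈id   : ∀ x → φ (φ⁻¹ x) ≈ x

    φ-injective : ∀ {a b} → φ a ≈ φ b → a ≈ b
    φ-injective {a} {b} φa≈φb = trans (sym (φ⁻¹∘φ≈id a)) (trans (φ⁻¹-cong φa≈φb) (φ⁻¹∘φ≈id b))

    φ⁻¹-injective : ∀ {a b} → φ⁻¹ a ≈ φ⁻¹ b → a ≈ b
    φ⁻¹-injective {a} {b} e = trans (sym (φ∘φ⁻¹≈id a)) (trans (φ-cong e) (φ∘φ⁻¹≈id b))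

  perm-pointwise : ∀ {f g} → (∀ x → f x ≈ g x) → IsPermutation F f ⇔ IsPermutation F g
  perm-pointwise {f} {g} f≈g = mk⇔ (transport f≈g) (transport (λ x → sym (f≈g x)))
    where
    transport : ∀ {f g} → (∀ x → f x ≈ g x) → IsPermutation F f → IsPermutation F g
    transport f≈g (f-inj , f-sur) =
        (λ a b ga≈gb → f-inj a b (trans (f≈g a) (trans ga≈gb (sym (f≈g b)))))
      , (λ y → let (x , fx≈y) = f-sur y in x , trans (sym (f≈g x)) fx≈y)

  perm-precompose : ∀ {φ f} → Invertible φ → Congruent f →
                    IsPermutation F f ⇔ IsPermutation F (f ∘ φ)
  perm-precompose {φ} {f} inv f-cong = mk⇔
    (λ (f-inj , f-sur) →
        (λ a b e → φ-injective (f-inj (φ a) (φ b) e))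
      , (λ y → let (x , fx≈y) = f-sur y in φ⁻¹ x , trans (f-cong (φ∘φ⁻¹≈id x)) fx≈y))
    (λ (fφ-inj , fφ-sur) →
        (λ a b e → φ⁻¹-injective (fφ-inj (φ⁻¹ a) (φ⁻¹ b)
          (trans (f-cong (φ∘φ⁻¹≈id a)) (trans e (sym (f-cong (φ∘φ⁻¹≈id b)))))))
      , (λ y → let (x , fφx≈y) = fφ-sur y in φ x , fφx≈y))
    where open Invertible inv

  perm-postcompose : ∀ {φ g} → Invertible φ → IsPermutation F g ⇔ IsPermutation F (φ ∘ g)
  perm-postcompose {φ} {g} inv = mk⇔
    (λ (g-inj , g-sur) →
        (λ a b e → g-inj a b (φ-injective e))
      , (λ y → let (x , gx≈φ⁻¹y) = g-sur (φ⁻¹ y) in x , trans (φ-cong gx≈φ⁻¹y) (φ∘φ⁻¹≈id y)))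
    (λ (φg-inj , φg-sur) →
        (λ a b e → φg-inj a b (φ-cong e))
      , (λ y → let (x , φgx≈φy) = φg-sur (φ y) in x , φ-injective φgx≈φy))
    where open Invertible inv

  affine : ∀ {a a′} b → a * a′ ≈ 1# → Invertible (λ x → a * (b + x))
  affine {a} {a′} b aa′≈1 = record
    { φ⁻¹      = λ y → a′ * y - b
    ; φ-cong   = λ e → *-congˡ (+-congˡ e)
    ; φ⁻¹-cong = λ e → +-congʳ (*-congˡ e)
    ; φ⁻¹∘φ≈id = λ x → begin
        a′ * (a * (b + x)) - b   ≈⟨ solve 4 (λ a a′ b x → a′ :* (a :* (b :+ x)) :- b := (a :* a′) :* (b :+ x) :- b) refl a a′ b x ⟩
        (a * a′) * (b + x) - b   ≈⟨ +-congʳ (*-congʳ aa′≈1) ⟩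
        1# * (b + x) - b         ≈⟨ solve 2 (λ b x → con (+ 1) :* (b :+ x) :- b := x) refl b x ⟩
        x                        ∎
    ; φ∘φ⁻¹≈id = λ y → begin
        a * (b + (a′ * y - b))   ≈⟨ solve 4 (λ a a′ b y → a :* (b :+ (a′ :* y :- b)) := (a :* a′) :* y) refl a a′ b y ⟩
        (a * a′) * y             ≈⟨ *-congʳ aa′≈1 ⟩
        1# * y                   ≈⟨ *-identityˡ y ⟩
        y                        ∎
    }
    where open import Relation.Binary.Reasoning.Setoid setoid

  affine⁻ : ∀ {a a′} b → a * a′ ≈ 1# → Invertible (λ x → a * (b - x))
  affine⁻ {a} {a′} b aa′≈1 = record
    { φ⁻¹      = λ y → b - a′ * y
    ; φ-cong   = λ e → *-congˡ (+-congˡ (-‿cong e))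
    ; φ⁻¹-cong = λ e → +-congˡ (-‿cong (*-congˡ e))
    ; φ⁻¹∘φ≈id = λ x → begin
        b - a′ * (a * (b - x))   ≈⟨ solve 4 (λ a a′ b x → b :- a′ :* (a :* (b :- x)) := b :- (a :* a′) :* (b :- x)) refl a a′ b x ⟩
        b - (a * a′) * (b - x)   ≈⟨ +-congˡ (-‿cong (*-congʳ aa′≈1)) ⟩
        b - 1# * (b - x)         ≈⟨ solve 2 (λ b x → b :- con (+ 1) :* (b :- x) := x) refl b x ⟩
        x                        ∎
    ; φ∘φ⁻¹≈id = λ y → begin
        a * (b - (b - a′ * y))   ≈⟨ solve 4 (λ a a′ b y → a :* (b :- (b :- a′ :* y)) := (a :* a′) :* y) refl a a′ b y ⟩
        (a * a′) * y             ≈⟨ *-congʳ aa′≈1 ⟩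
        1# * y                   ≈⟨ *-identityˡ y ⟩
        y                        ∎
    }
    where open import Relation.Binary.Reasoning.Setoid setoid

module OddCharacteristic {q : ℕ} (F : FiniteField q) where
  open FiniteField F
  open IntegerRingSolver cring using (solve; _:+_; _:*_; _:=_; con)
  open import Algebra.Properties.Semiring.Mult semiring using (_×_; ×-homo-+)
  open import Algebra.Properties.Semiring.Exp semiring using (_^_)
  open import Relation.Binary.Reasoning.Setoid setoid

  -- 2 = 0 would give p·1 = 1 + 2α·1 = 1, contradicting p·1 = 0
  two-nonzero : ∀ {p α} → Odd p α → p × 1# ≈ 0# → ¬ ι F 2 ≈ 0#
  two-nonzero {α = α} (odd ≡.refl) char-p 2≈0 = 1≉0 (begin
    1#                         ≈⟨ +-identityʳ 1# ⟨
    1# + 0#                    ≈⟨ +-congˡ (trans (*-congˡ 2≈0) (zeroʳ _)) ⟨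
    1# + (α × 1#) * ι F 2      ≈⟨ +-congˡ (solve 1 (λ u → u :* (con (+ 1) :+ (con (+ 1) :+ con (+ 0))) := u :+ u) refl (α × 1#)) ⟩
    1# + (α × 1# + α × 1#)     ≈⟨ +-congˡ (×-homo-+ 1# α α) ⟨
    suc (α ℕ.+ α) × 1#         ≈⟨ char-p ⟩
    0#                         ∎)

  half : ∀ {p α} → Odd p α → p × 1# ≈ 0# → ∃ λ t → ι F 2 * t ≈ 1#
  half p-odd char-p = inverse (ι F 2) (two-nonzero p-odd char-p)

  t+t≈1 : ∀ {t} → ι F 2 * t ≈ 1# → t + t ≈ 1#
  t+t≈1 {t} 2t≈1 = trans (solve 1 (λ t → t :+ t := (con (+ 1) :+ (con (+ 1) :+ con (+ 0))) :* t) refl t) 2t≈1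

  unit-^ : ∀ {a a′} → a * a′ ≈ 1# → ∀ n → a ^ n * a′ ^ n ≈ 1#
  unit-^ aa′≈1 zero    = *-identityˡ 1#
  unit-^ {a} {a′} aa′≈1 (suc n) = begin
    (a * a ^ n) * (a′ * a′ ^ n) ≈⟨ solve 4 (λ a a′ x y → (a :* x) :* (a′ :* y) := (a :* a′) :* (x :* y)) refl a a′ (a ^ n) (a′ ^ n) ⟩
    (a * a′) * (a ^ n * a′ ^ n) ≈⟨ *-cong aa′≈1 (unit-^ aa′≈1 n) ⟩
    1# * 1#                     ≈⟨ *-identityˡ 1# ⟩
    1#                          ∎

module Ingredients {p e : ℕ} (F : FiniteField (p ℕ.^ suc e)) (k l₁ l₂ l₃ l₄ : ℕ)
                   (p-prime : Prime p) (2∤p : ¬ 2 ∣ p) where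
  open FiniteField F
  open OddCharacteristic F
  open PermutationTransfer F using (Invertible; affine; affine⁻)
  open import Algebra.Properties.Semiring.Exp semiring using (_^_)
  open import Algebra.Properties.Semiring.Mult semiring using (_×_)

  N : ℕ
  N = p ℕ.^ l₁ ℕ.+ p ℕ.^ l₂ ℕ.+ p ℕ.^ l₃ ℕ.+ p ℕ.^ l₄

  c₂ : Carrier
  c₂ = ι F 2 - ι F k

  private
    α : ℕ
    α = proj₁ (odd-half p 2∤p)

    p-odd : Odd p α
    p-odd = proj₂ (odd-half p 2∤p)

    char-p : p × 1# ≈ 0#
    char-p = Characteristic.characteristic F p e ≡.refl

    oddᵢ : ∀ l → Odd (p ℕ.^ l) (proj₁ (odd-power p-odd l))
    oddᵢ l = proj₂ (odd-power p-odd l)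

  t : Carrier
  t = proj₁ (half p-odd char-p)

  2t≈1 : ι F 2 * t ≈ 1#
  2t≈1 = proj₂ (half p-odd char-p)

  substitution : Invertible (λ w → t * t * (1# - w))
  substitution = affine⁻ 1# (trans (*-cong (*-congˡ (sym (*-identityʳ t))) (*-congˡ (sym (*-identityʳ _))))
                                   (unit-^ (trans (*-comm t _) 2t≈1) 2))

  rescaling : Invertible (λ z → t ^ N * (c₂ + z))
  rescaling = affine c₂ (unit-^ (trans (*-comm t _) 2t≈1) N)

  dickson-via-h : ∀ w → D F N k (t * t * (1# - w)) ≈ t ^ N * (c₂ + h F p k l₁ l₂ l₃ l₄ w)
  dickson-via-h w = trans
    (DicksonClosedForm.dickson-at-sum F k w t (t+t≈1 2t≈1) p-prime char-p l₁ l₂ l₃ l₄ _ _ _ _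
       (oddᵢ l₁) (oddᵢ l₂) (oddᵢ l₃) (oddᵢ l₄))
    (*-congˡ (+-congˡ (sym (HalfPowerForm.h-as-hExpr F p k l₁ l₂ l₃ l₄ _ _ _ _
       (oddᵢ l₁) (oddᵢ l₂) (oddᵢ l₃) (oddᵢ l₄) w))))

-- the vocabulary of the statement (opened here, after the developments above,
-- so that the arithmetic of ℕ does not clash with the field operations there)
open import Data.Nat using (ℕ; _+_; _^_; _<_; _≤_)

mainTheorem16 : (p e k l₁ l₂ l₃ l₄ : ℕ) → Prime p → ¬ (2 ∣ p) → 1 ≤ e → k < p →
    (F : FiniteField (p ^ e)) →
    IsPermutation F (D F (p ^ l₁ + p ^ l₂ + p ^ l₃ + p ^ l₄) k)
      ⇔ IsPermutation F (h F p k l₁ l₂ l₃ l₄)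
mainTheorem16 p zero    k l₁ l₂ l₃ l₄ p-prime 2∤p () k<p F
mainTheorem16 p (suc e) k l₁ l₂ l₃ l₄ p-prime 2∤p _  _   F =
  ⇔.trans (perm-precompose substitution (DicksonClosedForm.D-cong F N k))
 (⇔.trans (perm-pointwise dickson-via-h)
          (⇔.sym (perm-postcompose rescaling)))
  where
  open Ingredients {e = e} F k l₁ l₂ l₃ l₄ p-prime 2∤p
  open PermutationTransfer F
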